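{- Let $x$ be a variable and $t\in\mathrm{CL}(\mathcal{B})$. (1) If $x\notin\mathrm{FV}(t)$ then $[x]_{T'}t=\mathsf{K}t$. (2) If $x\notin\mathrm{FV}(t)$ then $[x]_{T'}(tx)=t$.
   Context: Lambda-terms are considered up to $\alpha$-equivalence; $\mathrm{FV}(t)$ is the set of free variables of $t$. Fix the combinators $\mathsf{S}=\lambda xyz.xz(yz)$, $\mathsf{K}=\lambda xy.x$, $\mathsf{I}=\lambda x.x$, $\mathsf{B}=\lambda xyz.x(yz)$, $\mathsf{C}=\lambda xyz.xzy$, $\mathsf{S}'=\lambda kxyz.k(xz)(yz)$, $\mathsf{B}'=\lambda kxyz.kx(yz)$, $\mathsf{C}'=\lambda kxyz.k(xz)y$. Let $\mathcal{B}=\{\mathsf{S},\mathsf{K},\mathsf{I},\mathsf{B},\mathsf{C},\mathsf{S}',\mathsf{B}',\mathsf{C}'\}$ and let $\mathrm{CL}(\mathcal{B})$ be the set of terms built from variables and elements of $\mathcal{B}$ using only application (left-associative); equality of such terms is syntactic, combinators treated as atoms. Algorithm $T'$: $[x]_{T'}(st)=\mathrm{Opt}(\mathsf{S}([x]_{T'}s)([x]_{T'}t))$; $[x]_{T'}x=\mathsf{I}$; $[x]_{T'}t=\mathsf{K}t$ otherwise (for $t$ a variable other than $x$ or a constant), earlier equations taking precedence, where $\mathrm{Opt}$ is given by the first applicable clause: (1) $\mathrm{Opt}(\mathsf{S}(\mathsf{K}s)(\mathsf{K}t))=\mathsf{K}(st)$; (2) $\mathrm{Opt}(\mathsf{S}(\mathsf{K}s)\mathsf{I})=s$;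 (3) $\mathrm{Opt}(\mathsf{S}(\mathsf{K}(us))t)=\mathsf{B}'ust$; (4) $\mathrm{Opt}(\mathsf{S}(\mathsf{K}s)t)=\mathsf{B}st$; (5) $\mathrm{Opt}(\mathsf{S}(\mathsf{B}us)(\mathsf{K}t))=\mathsf{C}'ust$; (6) $\mathrm{Opt}(\mathsf{S}(\mathsf{B}'u_1u_2s)(\mathsf{K}t))=\mathsf{C}'(u_1u_2)st$; (7) $\mathrm{Opt}(\mathsf{S}s(\mathsf{K}t))=\mathsf{C}st$; (8) $\mathrm{Opt}(\mathsf{S}(\mathsf{B}us)t)=\mathsf{S}'ust$; (9) $\mathrm{Opt}(\mathsf{S}(\mathsf{B}'u_1u_2s)t)=\mathsf{S}'(u_1u_2)st$; (10) $\mathrm{Opt}(\mathsf{S}st)=\mathsf{S}st$. -}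

module Defs where

open import Data.Nat using (ℕ)
open import Data.Nat.Properties using (_≟_)
open import Relation.Nullary using (yes; no; ¬_)

Var : Set
Var = ℕ

data Comb : Set where
  cS cK cI cB cC cS' cB' cC' : Comb

data CL : Set where
  var  : Var → CL
  con  : Comb → CL
  _·_  : CL → CL → CL

infixl 9 _·_

S K I B C S' B' C' : CL
S  = con cS
K  = con cK
I  = con cI
B  = con cB
C  = con cC
S' = con cS'
B' = con cB'
C' = con cC'

data _∈FV_ (x : Var) : CL → Set where
  here  : x ∈FV var x
  left  : ∀ {s t} → x ∈FV s → x ∈FV (s · t)
  right : ∀ {s t} → x ∈FV t → x ∈FV (s · t)

_∉FV_ : Var → CL → Set
x ∉FV t = ¬ (x ∈FV t)

-- Opt(S a b), given the two arguments a b; clauses in order, first match wins.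
opt : CL → CL → CL
opt (con cK · s) (con cK · t) = K · (s · t)
opt (con cK · s) (con cI) = s
opt (con cK · (u · s)) t = B' · u · s · t
opt (con cK · s) t = B · s · t
opt (con cB · u · s) (con cK · t) = C' · u · s · t
opt (con cB' · u₁ · u₂ · s) (con cK · t) = C' · (u₁ · u₂) · s · t
opt s (con cK · t) = C · s · t
opt (con cB · u · s) t = S' · u · s · t
opt (con cB' · u₁ · u₂ · s) t = S' · (u₁ · u₂) · s · t
opt s t = S · s · t

abs : Var → CL → CL
abs x (s · t) = opt (abs x s) (abs x t)
abs x (var y) with x ≟ y
... | yes _ = I
... | no  _ = K · var y
abs x (con c) = K · con c

module Submission where

open import Defs
open import Data.Product using (_×_; _,_)
open import Data.Empty using (⊥-elim)
open import Data.Nat.Properties using (_≟_)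
open import Relation.Nullary using (yes; no)
open import Relation.Binary.PropositionalEquality using (_≡_; refl)

∉FV-appˡ : ∀ {x s t} → x ∉FV (s · t) → x ∉FV s
∉FV-appˡ x∉st x∈s = x∉st (left x∈s)

∉FV-appʳ : ∀ {x s t} → x ∉FV (s · t) → x ∉FV t
∉FV-appʳ x∉st x∈t = x∉st (right x∈t)

-- In the application case both abstractions are K-terms, so Opt fires clause (1).
abs-∉FV : (x : Var) (t : CL) → x ∉FV t → abs x t ≡ K · t
abs-∉FV x (var y) x∉y with x ≟ y
... | yes refl = ⊥-elim (x∉y here)
... | no _     = refl
abs-∉FV x (con c) _ = refl
abs-∉FV x (s · t) x∉st
  rewrite abs-∉FV x s (∉FV-appˡ x∉st) | abs-∉FV x t (∉FV-appʳ x∉st) = refl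

abs-self : (x : Var) → abs x (var x) ≡ I
abs-self x with x ≟ x
... | yes _  = refl
... | no x≢x = ⊥-elim (x≢x refl)

-- Clause (2) of Opt: S (K t) I becomes t.
abs-η : (x : Var) (t : CL) → x ∉FV t → abs x (t · var x) ≡ t
abs-η x t x∉t rewrite abs-∉FV x t x∉t | abs-self x = refl

mainTheorem8 : (x : Var) (t : CL) →
    ((x ∉FV t) → abs x t ≡ K · t) × ((x ∉FV t) → abs x (t · var x) ≡ t)
mainTheorem8 x t = abs-∉FV x t , abs-η x t
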